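{- Let $G$ be a finite simple graph and let $H$ be an induced subgraph of $G$. Then $\dim_{\mathrm{poc}}(H)\le\dim_{\mathrm{poc}}(G)$.
   Context: For $\mathbf{x},\mathbf{y}\in\mathbb{R}^d$, $\mathbf{x}\prec\mathbf{y}$ means $x_i<y_i$ for all $i$. For finite $S\subseteq\mathbb{R}^d$, $D_S$ is the digraph on $S$ with an arc $(\mathbf{x},\mathbf{v})$ whenever $\mathbf{v}\prec\mathbf{x}$; by convention $\mathbb{R}^0$ is a single point. The competition graph $C(D)$ of a digraph $D$ has vertex set $V(D)$ and an edge between distinct $x,y$ iff some $z$ has arcs $(x,z),(y,z)$. The partial order competition dimension $\dim_{\mathrm{poc}}(G)$ is the smallest nonnegative integer $d$ such that for some nonnegative integer $k$ and some finite $S\subseteq\mathbb{R}^d$, the disjoint union of $G$ and $k$ isolated vertices is isomorphic to $C(D_S)$.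
   Formalization: The finite sets S defining $D_S$ consist of points of ℚ^d rather than $\mathbb{R}^d$. -}

module Defs where

open import Level using (0ℓ)
open import Data.Nat using (ℕ; _+_; _≤_)
open import Data.Fin using (Fin; splitAt)
open import Data.Rational using (ℚ; _<_)
open import Data.Product using (Σ; ∃; _×_)
open import Data.Sum using (inj₁; inj₂)
open import Data.Empty using (⊥)
open import Relation.Nullary using (¬_)
open import Relation.Binary.PropositionalEquality using (_≡_)
open import Function.Bundles using (_⇔_)

record Graph : Set₁ where
  field
    n     : ℕ
    Adj   : Fin n → Fin n → Set
    sym   : ∀ {u v} → Adj u v → Adj v u
    irrefl : ∀ {u} → ¬ Adj u u
open Graph public

record InducedSubgraph (H G : Graph) : Set where
  field
    emb      : Fin (n H) → Fin (n G)
    emb-inj  : ∀ {u v} → emb u ≡ emb v → u ≡ v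
    emb-adj  : ∀ u v → Adj H u v ⇔ Adj G (emb u) (emb v)

Point : ℕ → Set
Point d = Fin d → ℚ

_≺_ : ∀ {d} → Point d → Point d → Set
x ≺ y = ∀ i → x i < y i

-- Adjacency of the disjoint union of G with k isolated vertices
-- (vertices Fin (n G + k); the first n G are those of G).
AdjPlus : (G : Graph) (k : ℕ) → Fin (n G + k) → Fin (n G + k) → Set
AdjPlus G k u v with splitAt (n G) u | splitAt (n G) v
... | inj₁ a | inj₁ b = Adj G a b
... | _      | _      = ⊥

-- G ∪ I_k ≅ C(D_S) for some finite S ⊆ Q^d: a labelling p of the vertices of
-- G ∪ I_k by pairwise distinct points (S = image of p, p the isomorphism) such
-- that u,v are adjacent iff u ≠ v and some z ∈ S has z ≺ p u and z ≺ p v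
-- (i.e. arcs (p u, z), (p v, z) in D_S).
Representable : Graph → ℕ → Set
Representable G d =
  Σ ℕ λ k → Σ (Fin (n G + k) → Point d) λ p →
    (∀ u v → (∀ c → p u c ≡ p v c) → u ≡ v) ×
    (∀ u v → AdjPlus G k u v ⇔
        ((¬ u ≡ v) × ∃ λ z → (p z ≺ p u) × (p z ≺ p v)))

-- dim_poc(H) ≤ dim_poc(G), unfolded from "smallest d":
-- whenever G is representable in dimension d, H is representable in some d' ≤ d.
DimLe : Graph → Graph → Set
DimLe H G = ∀ d → Representable G d → Σ ℕ λ d' → d' ≤ d × Representable H d'

{-# OPTIONS --safe #-}
-- Restrict a representation of G ∪ I_k to the points labelling H together with
-- all ≺-minimal points. Two points with a common prey also have a minimal common
-- prey (one of least first coordinate among their common prey), so no edge of H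
-- is lost; no edge is gained since the kept points are among the original ones;
-- and the minimal points, having no prey, are isolated vertices.
module Submission where

open import Defs hiding (sym)
open import Data.Nat using (ℕ; zero; suc; _+_)
open import Data.Nat.Properties using (≤-refl)
open import Data.Fin using (Fin; zero; suc; splitAt; join; _↑ˡ_; _↑ʳ_; _≟_)
open import Data.Fin.Properties using (all?; any?; splitAt-↑ˡ; splitAt-↑ʳ; join-splitAt; ↑ˡ-injective)
open import Data.Rational using (ℚ; _≤_)
open import Data.Rational.Properties using (_<?_; <-irrefl; <-trans; <-≤-trans; ≤-decTotalOrder)
open import Relation.Binary.Bundles using (DecTotalOrder)
open import Data.List using (List; filter; allFin; length; lookup)
open import Data.List.Extrema (DecTotalOrder.totalOrder ≤-decTotalOrder) using (argmin; argmin-all; f[argmin]≤f[xs])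
open import Data.List.Membership.Propositional using (_∈_)
open import Data.List.Membership.Propositional.Properties using (∈-filter⁺; ∈-filter⁻; ∈-allFin; ∈-lookup)
import Data.List.Relation.Unary.All as All
open import Data.List.Relation.Unary.AllPairs using (_∷_)
open import Data.List.Relation.Unary.All.Properties using (all-filter)
open import Data.List.Relation.Unary.Any using (index)
open import Data.List.Relation.Unary.Any.Properties using (lookup-index)
open import Data.List.Relation.Unary.Unique.Propositional using (Unique)
open import Data.List.Relation.Unary.Unique.Propositional.Properties using (allFin⁺; filter⁺)
open import Data.Product using (∃; _×_; _,_; proj₁; proj₂)
open import Data.Sum using (_⊎_; inj₁; inj₂; [_,_]′)
open import Data.Empty using (⊥-elim)
open import Function using (_∘_)
open import Function.Bundles using (_⇔_; mk⇔; Equivalence)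
open import Function.Properties.Equivalence using () renaming (trans to ⇔-trans)
open import Relation.Binary.PropositionalEquality using (_≡_; _≢_; refl; sym; trans; cong; subst)
open import Relation.Nullary using (¬_; Dec; yes; no; ¬?; _×-dec_)
open import Relation.Unary using (Decidable)

open Equivalence using (to)

data SplitAtView (m : ℕ) {n : ℕ} : Fin (m + n) → Set where
  ↑ˡ-view : (i : Fin m) → SplitAtView m (i ↑ˡ n)
  ↑ʳ-view : (j : Fin n) → SplitAtView m (m ↑ʳ j)

splitAt-view : ∀ m {n} (i : Fin (m + n)) → SplitAtView m i
splitAt-view m {n} i = subst (SplitAtView m) (join-splitAt m n i) (view (splitAt m i))
  where
  view : (s : Fin m ⊎ Fin n) → SplitAtView m (join m n s)
  view (inj₁ a) = ↑ˡ-view a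
  view (inj₂ b) = ↑ʳ-view b

splitAt-injective : ∀ m {n} {i j : Fin (m + n)} → splitAt m i ≡ splitAt m j → i ≡ j
splitAt-injective m {n} {i} {j} eq =
  trans (sym (join-splitAt m n i)) (trans (cong (join m n) eq) (join-splitAt m n j))

[,]′-injective : ∀ {A B C : Set} {f : A → C} {g : B → C} →
  (∀ {a a'} → f a ≡ f a' → a ≡ a') → (∀ {b b'} → g b ≡ g b' → b ≡ b') → (∀ a b → f a ≢ g b) →
  ∀ {s t} → [ f , g ]′ s ≡ [ f , g ]′ t → s ≡ t
[,]′-injective f-inj g-inj f≢g {inj₁ a} {inj₁ a'} eq = cong inj₁ (f-inj eq)
[,]′-injective f-inj g-inj f≢g {inj₂ b} {inj₂ b'} eq = cong inj₂ (g-inj eq)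
[,]′-injective f-inj g-inj f≢g {inj₁ a} {inj₂ b}  eq = ⊥-elim (f≢g a b eq)
[,]′-injective f-inj g-inj f≢g {inj₂ b} {inj₁ a}  eq = ⊥-elim (f≢g a b (sym eq))

Unique⇒lookup-injective : ∀ {A : Set} {xs : List A} → Unique xs →
  ∀ {i j} → lookup xs i ≡ lookup xs j → i ≡ j
Unique⇒lookup-injective (_ ∷ _)      {zero}  {zero}  _  = refl
Unique⇒lookup-injective (x∉xs ∷ _)   {zero}  {suc j} eq = ⊥-elim (All.lookup x∉xs (∈-lookup j) eq)
Unique⇒lookup-injective (x∉xs ∷ _)   {suc i} {zero}  eq = ⊥-elim (All.lookup x∉xs (∈-lookup i) (sym eq))
Unique⇒lookup-injective (_ ∷ unique) {suc i} {suc j} eq = cong suc (Unique⇒lookup-injective unique eq)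

AdjPlus-↑ˡ : ∀ G k (u v : Fin (n G)) → AdjPlus G k (u ↑ˡ k) (v ↑ˡ k) ≡ Adj G u v
AdjPlus-↑ˡ G k u v rewrite splitAt-↑ˡ (n G) u k | splitAt-↑ˡ (n G) v k = refl

AdjPlus-↑ʳ-left : ∀ G k j v → ¬ AdjPlus G k (n G ↑ʳ j) v
AdjPlus-↑ʳ-left G k j v rewrite splitAt-↑ʳ (n G) k j with splitAt (n G) v
... | inj₁ _ = λ ()
... | inj₂ _ = λ ()

AdjPlus-↑ʳ-right : ∀ G k u j → ¬ AdjPlus G k u (n G ↑ʳ j)
AdjPlus-↑ʳ-right G k u j rewrite splitAt-↑ʳ (n G) k j with splitAt (n G) u
... | inj₁ _ = λ ()
... | inj₂ _ = λ ()

_≺?_ : ∀ {d} (x y : Point d) → Dec (x ≺ y)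
x ≺? y = all? (λ i → x i <? y i)

≺-trans : ∀ {d} {x y z : Point d} → x ≺ y → y ≺ z → x ≺ z
≺-trans x≺y y≺z i = <-trans (x≺y i) (y≺z i)

module _ {m d : ℕ} (p : Fin m → Point d) where

  PointwiseInjective : Set
  PointwiseInjective = ∀ u v → (∀ c → p u c ≡ p v c) → u ≡ v

  Minimal : Fin m → Set
  Minimal a = ∀ b → ¬ p b ≺ p a

  minimal? : Decidable Minimal
  minimal? a = all? (λ b → ¬? (p b ≺? p a))

  CommonPrey : Fin m → Fin m → Set
  CommonPrey a b = ∃ λ z → p z ≺ p a × p z ≺ p b

-- A point of least first coordinate in a down-closed set is ≺-minimal.
minimal-in-downset : ∀ {m d} (p : Fin m → Point (suc d)) {P : Fin m → Set} → Decidable P →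
  (∀ {w z} → p w ≺ p z → P z → P w) → ∀ {z} → P z → ∃ λ z₀ → P z₀ × Minimal p z₀
minimal-in-downset {m} p {P} P? P-down {z} Pz = z₀ , P[z₀] , z₀-minimal
  where
  height : Fin m → ℚ
  height w = p w zero

  z₀ : Fin m
  z₀ = argmin height z (filter P? (allFin m))

  P[z₀] : P z₀
  P[z₀] = argmin-all height Pz (all-filter P? (allFin m))

  z₀-minimal : Minimal p z₀
  z₀-minimal w w≺z₀ = <-irrefl refl (<-≤-trans (w≺z₀ zero) z₀≤w)
    where
    z₀≤w : height z₀ ≤ height w
    z₀≤w = All.lookup (f[argmin]≤f[xs] z (filter P? (allFin m)))
                      (∈-filter⁺ P? (∈-allFin w) (P-down w≺z₀ P[z₀]))

minimal-common-prey : ∀ {m d} (p : Fin m → Point d) → PointwiseInjective p →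
  ∀ {a b} → a ≢ b → CommonPrey p a b → ∃ λ z₀ → Minimal p z₀ × p z₀ ≺ p a × p z₀ ≺ p b
-- In dimension 0 every point precedes itself, so nothing is minimal; there,
-- injectivity leaves no two distinct vertices instead.
minimal-common-prey {d = zero} p p-inj {a} {b} a≢b _ = ⊥-elim (a≢b (p-inj a b λ ()))
minimal-common-prey {d = suc d} p _ {a} {b} _ (z , z≺a , z≺b)
  with minimal-in-downset p (λ w → p w ≺? p a ×-dec p w ≺? p b)
         (λ w≺z (z≺a , z≺b) → ≺-trans w≺z z≺a , ≺-trans w≺z z≺b) (z≺a , z≺b)
... | z₀ , (z₀≺a , z₀≺b) , z₀-minimal = z₀ , z₀-minimal , z₀≺a , z₀≺b

module Restriction {G H : Graph} (H⊆G : InducedSubgraph H G) {d k : ℕ}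
  (p : Fin (n G + k) → Point d) (p-inj : PointwiseInjective p)
  (p-adj : ∀ u v → AdjPlus G k u v ⇔ (u ≢ v × CommonPrey p u v)) where

  open InducedSubgraph H⊆G

  minimal-isolatedˡ : ∀ {a b} → Minimal p a → ¬ AdjPlus G k a b
  minimal-isolatedˡ {a} {b} a-minimal adj with to (p-adj a b) adj
  ... | _ , z , z≺a , _ = a-minimal z z≺a

  minimal-isolatedʳ : ∀ {a b} → Minimal p b → ¬ AdjPlus G k a b
  minimal-isolatedʳ {a} {b} b-minimal adj with to (p-adj a b) adj
  ... | _ , z , _ , z≺b = b-minimal z z≺b

  vertex : Fin (n H) → Fin (n G + k)
  vertex u = emb u ↑ˡ k

  Spare : Fin (n G + k) → Set
  Spare a = Minimal p a × ¬ (∃ λ u → vertex u ≡ a)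

  spare? : Decidable Spare
  spare? a = minimal? p a ×-dec ¬? (any? (λ u → vertex u ≟ a))

  spares : List (Fin (n G + k))
  spares = filter spare? (allFin _)

  k′ : ℕ
  k′ = length spares

  spare : Fin k′ → Fin (n G + k)
  spare = lookup spares

  spare-minimal : ∀ j → Minimal p (spare j)
  spare-minimal j = proj₁ (proj₂ (∈-filter⁻ spare? {xs = allFin _} (∈-lookup j)))

  vertex≢spare : ∀ u j → vertex u ≢ spare j
  vertex≢spare u j eq = proj₂ (proj₂ (∈-filter⁻ spare? {xs = allFin _} (∈-lookup j))) (u , eq)

  kept : Fin (n H + k′) → Fin (n G + k)
  kept = [ vertex , spare ]′ ∘ splitAt (n H)

  kept-↑ˡ : ∀ u → kept (u ↑ˡ k′) ≡ vertex u
  kept-↑ˡ u = cong [ vertex , spare ]′ (splitAt-↑ˡ (n H) u k′)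

  kept-↑ʳ : ∀ j → kept (n H ↑ʳ j) ≡ spare j
  kept-↑ʳ j = cong [ vertex , spare ]′ (splitAt-↑ʳ (n H) k′ j)

  kept-↑ʳ-minimal : ∀ j → Minimal p (kept (n H ↑ʳ j))
  kept-↑ʳ-minimal j = subst (Minimal p) (sym (kept-↑ʳ j)) (spare-minimal j)

  kept-injective : ∀ {c c′} → kept c ≡ kept c′ → c ≡ c′
  kept-injective = splitAt-injective (n H) ∘ [,]′-injective vertex-injective spare-injective vertex≢spare
    where
    vertex-injective : ∀ {u v} → vertex u ≡ vertex v → u ≡ v
    vertex-injective = emb-inj ∘ ↑ˡ-injective k _ _
    spare-injective : ∀ {i j} → spare i ≡ spare j → i ≡ j
    spare-injective = Unique⇒lookup-injective (filter⁺ spare? (allFin⁺ _))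

  minimal-kept : ∀ {a} → Minimal p a → ∃ λ c → kept c ≡ a
  minimal-kept {a} a-minimal with any? (λ u → vertex u ≟ a)
  ... | yes (u , refl) = u ↑ˡ k′ , kept-↑ˡ u
  ... | no not-vertex = n H ↑ʳ index a∈spares , trans (kept-↑ʳ _) (sym (lookup-index a∈spares))
    where
    a∈spares : a ∈ spares
    a∈spares = ∈-filter⁺ spare? (∈-allFin a) (a-minimal , not-vertex)

  q : Fin (n H + k′) → Point d
  q = p ∘ kept

  q-injective : PointwiseInjective q
  q-injective c c′ = kept-injective ∘ p-inj (kept c) (kept c′)

  kept-competition : ∀ c c′ → (kept c ≢ kept c′ × CommonPrey p (kept c) (kept c′)) ⇔ (c ≢ c′ × CommonPrey q c c′)
  kept-competition c c′ = mk⇔ restrict (λ (c≢c′ , z , z≺c , z≺c′) → c≢c′ ∘ kept-injective , kept z , z≺c , z≺c′)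
    where
    restrict : kept c ≢ kept c′ × CommonPrey p (kept c) (kept c′) → c ≢ c′ × CommonPrey q c c′
    restrict (a≢b , prey) with minimal-common-prey p p-inj a≢b prey
    ... | z₀ , z₀-minimal , z₀≺a , z₀≺b with minimal-kept z₀-minimal
    ...   | z , refl = a≢b ∘ cong kept , z , z₀≺a , z₀≺b

  kept-adjacency : ∀ c c′ → AdjPlus H k′ c c′ ⇔ AdjPlus G k (kept c) (kept c′)
  kept-adjacency c c′ with splitAt-view (n H) c | splitAt-view (n H) c′
  ... | ↑ˡ-view u | ↑ˡ-view v
    rewrite kept-↑ˡ u | kept-↑ˡ v | AdjPlus-↑ˡ H k′ u v | AdjPlus-↑ˡ G k (emb u) (emb v) = emb-adj u v
  ... | ↑ʳ-view j | _ = mk⇔ (⊥-elim ∘ AdjPlus-↑ʳ-left H k′ j _) (⊥-elim ∘ minimal-isolatedˡ (kept-↑ʳ-minimal j))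
  ... | ↑ˡ-view _ | ↑ʳ-view j = mk⇔ (⊥-elim ∘ AdjPlus-↑ʳ-right H k′ _ j) (⊥-elim ∘ minimal-isolatedʳ (kept-↑ʳ-minimal j))

  representable : Representable H d
  representable = k′ , q , q-injective , λ c c′ →
    ⇔-trans (kept-adjacency c c′) (⇔-trans (p-adj (kept c) (kept c′)) (kept-competition c c′))

proposition3p8 : (G H : Graph) → InducedSubgraph H G → DimLe H G
proposition3p8 G H H⊆G d (k , p , p-inj , p-adj) = d , ≤-refl , Restriction.representable H⊆G p p-inj p-adj
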